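{- Let $G$ be a broken $x$-$y$-outerplanar graph with outer path $P$, and let $(L,M)$ be a valid cover of $G$. Then for any edge $e=uv$ of $G$: (i) every node $a\in L(u)$ satisfies $|N_{M_e}(a)|\le \lambda_{M_e}(v)$; (ii) there are at most two nodes $a\in L(u)$ with $|N_{M_e}(a)|\ge 2$; (iii) if $\lambda_{M_e}(u)\ge 2$, then there are at most two nodes $a\in L(u)$ with $|N_{M_e}(a)|\ge \min\{2,\lambda_{M_e}(v)\}$.
   Context: An $x$-$y$-outerplanar graph is a simple 2-connected outerplane graph in which $xy$ is an edge incident with the unbounded face. A broken $x$-$y$-outerplanar graph is either a single edge $K_2$ with ends $x,y$, or a graph obtained from an $x$-$y$-outerplanar graph by deleting the edge $xy$; it has a spanning $x$–$y$ path $P$ (the outer path, the boundary of the outer face minus $xy$) such that all other edges lie on one side of $P$ in the embedding. A cover of $G$ is a pair $(L,M)$ where the sets $L(v)$ ($v\in V(G)$, elements called nodes) are pairwise disjoint and for each edge $e=uv$, $M_e$ is a bipartite graph with parts $L(u),L(v)$ (its edges are called links); $N_{M_e}(a)$ is the set of neighbours of node $a$ in $M_e$. Say $M_e$ is a subgraph of $K_{2,2}$ if all its links lie between some $A\subseteq L(u)$ and $B\subseteq L(v)$ with $|A|,|B|\le2$. Define $\lambda_{M_e}(v)$ for $e=uv$: if $M_e$ is a matching, $\lambda_{M_e}(v)=1$; if $M_e$ is a subgraph of $K_{2,2}$ with maximum degree 2, $\lambda_{M_e}(v)=1$ if $M_e$ is a copy of $K_{1,2}$ whose degree-2 node lies in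 $L(v)$, and $\lambda_{M_e}(v)=2$ otherwise; if $M_e$ is neither of these but is given (as part of the data) as the union of link-disjoint graphs $M_e'$, a matching, and $M_e''$, a subgraph of $K_{2,2}$, then $\lambda_{M_e}(v)=1+\lambda_{M_e''}(v)$. Let $\lambda_{(L,M)}(v)=\sum_{e\ni v}\lambda_{M_e}(v)$ and $\ell_{(L,M)}(v)=\min\{5,\lambda_{(L,M)}(v)\}$. $(L,M)$ is valid if: (1) for $e\in E(P)$, $M_e$ is a matching, or a subgraph of $K_{2,2}$, or the union of a matching and a subgraph of $K_{2,2}$; (2) $M_e$ is a matching for $e\in E(G)\setminus E(P)$; (3) $|L(v)|\ge \ell_{(L,M)}(v)$ for every $v$, and moreover if $e=uv\in E(P)$ and some node $z\in L(u)$ has degree 3 in $M_e$, then $|L(v)|\ge5$; (4) if $G\cong K_2$ with edge $e=xy$, then $M_e$ is a subgraph of $K_{2,2}$. -}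

module Defs where

open import Data.Nat using (ℕ; zero; suc; _+_; _≤_; _<_; _≤ᵇ_; _≡ᵇ_; _⊓_)
open import Data.Fin using (Fin; toℕ)
open import Data.Bool using (Bool; true; false; if_then_else_; _∧_; _∨_; T; not)
open import Data.Maybe using (Maybe; just; nothing)
open import Data.Product using (Σ; _×_; _,_; ∃₂)
open import Data.Sum using (_⊎_)
open import Relation.Nullary using (¬_)
open import Relation.Binary.PropositionalEquality using (_≡_)

sumFin : ∀ {m} → (Fin m → ℕ) → ℕ
sumFin {zero}  f = 0
sumFin {suc m} f = f Data.Fin.zero + sumFin (λ i → f (Data.Fin.suc i))

count : ∀ {m} → (Fin m → Bool) → ℕ
count p = sumFin (λ i → if p i then 1 else 0)

allB : ∀ {m} → (Fin m → Bool) → Bool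
allB {zero}  p = true
allB {suc m} p = p Data.Fin.zero ∧ allB (λ i → p (Data.Fin.suc i))

anyB : ∀ {m} → (Fin m → Bool) → Bool
anyB p = not (allB (λ i → not (p i)))

-- Vertices are Fin n, x = 0, y = n-1, the outer path P is 0-1-2-...-(n-1);
-- all other edges are chords {i,j} (i+2 ≤ j), pairwise non-crossing
-- (so they can all be drawn on one side of P), and {0,n-1} (= xy) is not
-- an edge.  For n = 2 this is exactly K₂.

record BrokenOuterplanar (n : ℕ) : Set where
  field
    two≤n       : 2 ≤ n
    chord       : Fin n → Fin n → Bool
    chord-long  : ∀ i j → T (chord i j) → 2 + toℕ i ≤ toℕ j
    chord-notxy : ∀ i j → T (chord i j) → ¬ (toℕ i ≡ 0 × suc (toℕ j) ≡ n)
    noncrossing : ∀ a b c d → T (chord a b) → T (chord c d) →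
                  ¬ (toℕ a < toℕ c × toℕ c < toℕ b × toℕ b < toℕ d)

module _ {n : ℕ} (G : BrokenOuterplanar n) where
  open BrokenOuterplanar G

  pathB : Fin n → Fin n → Bool
  pathB i j = toℕ j ≡ᵇ suc (toℕ i)

  -- edge {i,j} with i < j (edges are always written with the smaller end first)
  edgeB : Fin n → Fin n → Bool
  edgeB i j = pathB i j ∨ chord i j

  IsEdge : Fin n → Fin n → Set
  IsEdge i j = toℕ i < toℕ j × T (edgeB i j)

  IsPathEdge : Fin n → Fin n → Set
  IsPathEdge i j = T (pathB i j)

-- Bipartite graphs between L(u) = Fin a and L(v) = Fin b (links).

Rel : ℕ → ℕ → Set
Rel a b = Fin a → Fin b → Bool

flipR : ∀ {a b} → Rel a b → Rel b a
flipR R j i = R i j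

degL : ∀ {a b} → Rel a b → Fin a → ℕ
degL R i = count (λ j → R i j)

degR : ∀ {a b} → Rel a b → Fin b → ℕ
degR R j = count (λ i → R i j)

numLinks : ∀ {a b} → Rel a b → ℕ
numLinks R = sumFin (degL R)

isMatching : ∀ {a b} → Rel a b → Bool
isMatching R = allB (λ i → degL R i ≤ᵇ 1) ∧ allB (λ j → degR R j ≤ᵇ 1)

-- subgraph of K_{2,2}: all links lie between some A ⊆ L(u), B ⊆ L(v) with
-- |A|,|B| ≤ 2; (take A, B = the nodes incident with links)
isSubK22 : ∀ {a b} → Rel a b → Bool
isSubK22 R = (count (λ i → 1 ≤ᵇ degL R i) ≤ᵇ 2) ∧ (count (λ j → 1 ≤ᵇ degR R j) ≤ᵇ 2)

isK12-centreR : ∀ {a b} → Rel a b → Bool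
isK12-centreR R = (numLinks R ≡ᵇ 2) ∧ anyB (λ j → degR R j ≡ᵇ 2)

-- λ at the right-hand vertex for a subgraph of K_{2,2}
-- (a matching gives 1; otherwise max degree 2 and the K_{1,2} rule applies)
λK22R : ∀ {a b} → Rel a b → ℕ
λK22R R = if isMatching R then 1 else (if isK12-centreR R then 1 else 2)

-- decomposition data M_e = M'_e ∪ M''_e
Decomp : ℕ → ℕ → Set
Decomp a b = Rel a b × Rel a b

-- λ_{M_e}(v) for v the right-hand end of e; the optional decomposition is
-- part of the cover data. (Value 0 in the "undefined" case is never used for a
-- valid cover.)
λR : ∀ {a b} → Rel a b → Maybe (Decomp a b) → ℕ
λR R d with isMatching R | isSubK22 R | d
... | true  | _     | _ = 1
... | false | true  | _ = λK22R R
... | false | false | just (M′ , M″) = 1 + λK22R M″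
... | false | false | nothing = 0

flipD : ∀ {a b} → Maybe (Decomp a b) → Maybe (Decomp b a)
flipD (just (M′ , M″)) = just (flipR M′ , flipR M″)
flipD nothing = nothing

λL : ∀ {a b} → Rel a b → Maybe (Decomp a b) → ℕ
λL R d = λR (flipR R) (flipD d)

-- L(v) = Fin (size v) (disjointness of the L(v) is built in by
-- tagging nodes with their vertex).  For i < j, M i j is the bipartite graph
-- with parts L(i), L(j), and dec i j the optional decomposition data; these are
-- only consulted when {i,j} is an edge.

record Cover (n : ℕ) : Set where
  field
    size : Fin n → ℕ
    M    : (i j : Fin n) → Rel (size i) (size j)
    dec  : (i j : Fin n) → Maybe (Decomp (size i) (size j))

module _ {n : ℕ} (G : BrokenOuterplanar n) (C : Cover n) where
  open Cover C

  λLM : Fin n → ℕ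
  λLM v = sumFin (λ w →
            (if (toℕ w <ᵇ' toℕ v) ∧ edgeB G w v then λR (M w v) (dec w v) else 0)
          + (if (toℕ v <ᵇ' toℕ w) ∧ edgeB G v w then λL (M v w) (dec v w) else 0))
    where
    _<ᵇ'_ : ℕ → ℕ → Bool
    x <ᵇ' y = suc x ≤ᵇ y

  ℓLM : Fin n → ℕ
  ℓLM v = 5 ⊓ λLM v

  IsMatchK22Union : ∀ {a b} → Rel a b → Maybe (Decomp a b) → Set
  IsMatchK22Union R d = Σ (Decomp _ _) λ { (M′ , M″) →
      d ≡ just (M′ , M″)
    × T (isMatching M′) × T (isSubK22 M″)
    × (∀ x y → ¬ (T (M′ x y) × T (M″ x y)))
    × (∀ x y → R x y ≡ (M′ x y ∨ M″ x y)) }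

  record Valid : Set where
    field
      v1 : ∀ i j → IsEdge G i j → IsPathEdge G i j →
           T (isMatching (M i j)) ⊎ T (isSubK22 (M i j)) ⊎ IsMatchK22Union (M i j) (dec i j)
      v2 : ∀ i j → IsEdge G i j → ¬ IsPathEdge G i j → T (isMatching (M i j))
      v3 : ∀ v → ℓLM v ≤ size v
      v3L : ∀ i j → IsEdge G i j → IsPathEdge G i j →
            ∀ z → degL (M i j) z ≡ 3 → 5 ≤ size j
      v3R : ∀ i j → IsEdge G i j → IsPathEdge G i j →
            ∀ z → degR (M i j) z ≡ 3 → 5 ≤ size i
      -- (4) G ≅ K₂ iff n = 2
      v4 : n ≡ 2 → ∀ i j → IsEdge G i j → T (isSubK22 (M i j))

Conclusions : ∀ {a b} → Rel a b → (lu lv : ℕ) → Set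
Conclusions R lu lv =
    (∀ x → degL R x ≤ lv)
  × (count (λ x → 2 ≤ᵇ degL R x) ≤ 2)
  × (2 ≤ lu → count (λ x → (2 ⊓ lv) ≤ᵇ degL R x) ≤ 2)

{-# OPTIONS --safe #-}
-- Only the local shape of M_e matters.  A matching has degrees ≤ 1; a subgraph of K₂,₂ has
-- degrees ≤ 2, and ≤ 1 on the leaf side of a K₁,₂ (a second link there would make three), and
-- at most two non-isolated nodes per side, which bounds the nodes of degree ≥ min{2, λ}.  In a
-- union M′ ∪ M″ a node's degree exceeds its M″-degree by at most one, so nodes of degree ≥ 2
-- are non-isolated in M″.  Swapping the two sides of M_e gives the statement at the other end.
module Submission where

open import Defs
open import Data.Nat using (ℕ; zero; suc; _+_; _≤_; _≤ᵇ_; _≡ᵇ_; _⊓_; _≤?_; z≤n; s≤s; s≤s⁻¹)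
open import Data.Nat.Properties hiding (suc-injective)
open import Algebra.Properties.CommutativeSemigroup +-commutativeSemigroup using (interchange)
open import Data.Fin using (Fin; zero; suc)
open import Data.Fin.Properties using (suc-injective)
open import Data.Bool using (Bool; true; false; if_then_else_; _∨_; T)
open import Data.Bool.Properties using (∧-comm; T?; T-≡; T-∧)
open import Data.Maybe using (Maybe; just; nothing)
open import Data.Product using (_×_; _,_; ∃; ∃₂; proj₁; proj₂)
open import Data.Sum using (_⊎_; inj₁; inj₂)
open import Function using (_∘_; Equivalence)
open import Data.Empty using (⊥-elim)
open import Relation.Nullary using (¬_; yes; no; contradiction)
open import Relation.Binary.PropositionalEquality

open Equivalence using (to; from)

private
  variable
    a b m : ℕ

¬T⇒≡false : ∀ {x} → ¬ T x → x ≡ false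
¬T⇒≡false {false} _  = refl
¬T⇒≡false {true}  ¬t = ⊥-elim (¬t _)

indicator : Bool → ℕ
indicator x = if x then 1 else 0

indicator-mono : ∀ x y → (T x → T y) → indicator x ≤ indicator y
indicator-mono false y x⇒y = z≤n
indicator-mono true  true  x⇒y = ≤-refl
indicator-mono true  false x⇒y = ⊥-elim (x⇒y _)

indicator-∨ : ∀ x y → indicator (x ∨ y) ≤ indicator x + indicator y
indicator-∨ true  y = s≤s z≤n
indicator-∨ false y = ≤-refl

sumFin-mono : {f g : Fin m → ℕ} → (∀ i → f i ≤ g i) → sumFin f ≤ sumFin g
sumFin-mono {zero}  f≤g = z≤n
sumFin-mono {suc m} f≤g = +-mono-≤ (f≤g zero) (sumFin-mono (f≤g ∘ suc))

sumFin-+ : (f g : Fin m → ℕ) → sumFin (λ i → f i + g i) ≡ sumFin f + sumFin g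
sumFin-+ {zero}  f g = refl
sumFin-+ {suc m} f g = trans (cong (f zero + g zero +_) (sumFin-+ (f ∘ suc) (g ∘ suc)))
                             (interchange (f zero) (g zero) (sumFin (f ∘ suc)) (sumFin (g ∘ suc)))

term≤sumFin : (f : Fin m → ℕ) (i : Fin m) → f i ≤ sumFin f
term≤sumFin f zero    = m≤m+n _ _
term≤sumFin f (suc i) = ≤-trans (term≤sumFin (f ∘ suc) i) (m≤n+m _ _)

two-terms≤sumFin : (f : Fin m → ℕ) {i j : Fin m} → i ≢ j → f i + f j ≤ sumFin f
two-terms≤sumFin f {zero}  {zero}  i≢j = contradiction refl i≢j
two-terms≤sumFin f {zero}  {suc j} i≢j = +-monoʳ-≤ (f zero) (term≤sumFin (f ∘ suc) j)
two-terms≤sumFin f {suc i} {zero}  i≢j =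
  subst (_≤ sumFin f) (+-comm (f zero) (f (suc i))) (+-monoʳ-≤ (f zero) (term≤sumFin (f ∘ suc) i))
two-terms≤sumFin f {suc i} {suc j} i≢j =
  ≤-trans (two-terms≤sumFin (f ∘ suc) (i≢j ∘ cong suc)) (m≤n+m _ _)

count-mono : {p q : Fin m → Bool} → (∀ i → T (p i) → T (q i)) → count p ≤ count q
count-mono {p = p} {q} p⇒q = sumFin-mono (λ i → indicator-mono (p i) (q i) (p⇒q i))

count-∨ : (p q : Fin m → Bool) → count (λ i → p i ∨ q i) ≤ count p + count q
count-∨ p q = ≤-trans (sumFin-mono (λ i → indicator-∨ (p i) (q i)))
                      (≤-reflexive (sumFin-+ (indicator ∘ p) (indicator ∘ q)))

count-false : count {m} (λ _ → false) ≡ 0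
count-false {zero}  = refl
count-false {suc m} = count-false {m}

count-none : {p : Fin m → Bool} → (∀ i → ¬ T (p i)) → count p ≡ 0
count-none {m} none = n≤0⇒n≡0 (≤-trans (count-mono {q = λ _ → false} (λ i → ⊥-elim ∘ none i)) (≤-reflexive (count-false {m})))

count-≤ᵇ-antitone : {k k′ : ℕ} (f : Fin m → ℕ) → k ≤ k′ →
                    count (λ i → k′ ≤ᵇ f i) ≤ count (λ i → k ≤ᵇ f i)
count-≤ᵇ-antitone f k≤k′ = count-mono (λ i → ≤⇒≤ᵇ ∘ ≤-trans k≤k′ ∘ ≤ᵇ⇒≤ _ (f i))

witness⇒1≤count : (p : Fin m → Bool) {i : Fin m} → T (p i) → 1 ≤ count p
witness⇒1≤count p {i} pi = ≤-trans (indicator-mono true (p i) (λ _ → pi)) (term≤sumFin (indicator ∘ p) i)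

1≤count⇒witness : (p : Fin m → Bool) → 1 ≤ count p → ∃ λ i → T (p i)
1≤count⇒witness {suc m} p h with p zero in eq
... | true  = zero , from T-≡ eq
... | false = let i , pi = 1≤count⇒witness (p ∘ suc) h in suc i , pi

2≤count⇒other-witness : (p : Fin m → Bool) (x : Fin m) → 2 ≤ count p → ∃ λ y → y ≢ x × T (p y)
2≤count⇒other-witness {suc m} p x h with p zero in eq | x
... | true  | suc _ = zero , (λ ()) , from T-≡ eq
... | true  | zero  = let i , pi = 1≤count⇒witness (p ∘ suc) (s≤s⁻¹ h) in suc i , (λ ()) , pi
... | false | zero  = let i , pi = 1≤count⇒witness (p ∘ suc) (≤-trans (s≤s z≤n) h) in suc i , (λ ()) , pi
... | false | suc x′ =
  let y , y≢x′ , py = 2≤count⇒other-witness (p ∘ suc) x′ h in suc y , y≢x′ ∘ suc-injective , py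

allB⇒ : (p : Fin m → Bool) → T (allB p) → ∀ i → T (p i)
allB⇒ p h zero    = proj₁ (to T-∧ h)
allB⇒ p h (suc i) = allB⇒ (p ∘ suc) (proj₂ (to (T-∧ {p zero}) h)) i

anyB⇒ : (p : Fin m → Bool) → T (anyB p) → ∃ λ i → T (p i)
anyB⇒ {suc m} p h with p zero in eq
... | true  = zero , from T-≡ eq
... | false = let i , pi = anyB⇒ (p ∘ suc) h in suc i , pi

isMatching⇒degL≤1 : (R : Rel a b) → T (isMatching R) → ∀ x → degL R x ≤ 1
isMatching⇒degL≤1 R h x = ≤ᵇ⇒≤ _ 1 (allB⇒ (λ i → degL R i ≤ᵇ 1) (proj₁ (to T-∧ h)) x)

isSubK22⇒degL≤2 : (R : Rel a b) → T (isSubK22 R) → ∀ x → degL R x ≤ 2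
isSubK22⇒degL≤2 R h x = ≤-trans
  (count-mono (λ j Rxj → ≤⇒≤ᵇ (witness⇒1≤count (λ i → R i j) Rxj)))
  (≤ᵇ⇒≤ _ 2 (proj₂ (to (T-∧ {count (λ i → 1 ≤ᵇ degL R i) ≤ᵇ 2}) h)))

isK12-centreR⇒degL≤1 : (R : Rel a b) → T (isK12-centreR R) → ∀ x → degL R x ≤ 1
isK12-centreR⇒degL≤1 R h x with degL R x ≤? 1
... | yes deg≤1 = deg≤1
... | no  deg≰1 =
  let two-links , centre = to (T-∧ {numLinks R ≡ᵇ 2}) h
      j , degj≡2 = anyB⇒ (λ j → degR R j ≡ᵇ 2) centre
      x′ , x′≢x , Rx′j = 2≤count⇒other-witness (λ i → R i j) x (≤-reflexive (sym (≡ᵇ⇒≡ _ 2 degj≡2)))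
      3≤links = ≤-trans (+-mono-≤ (≰⇒> deg≰1) (witness⇒1≤count (R x′) Rx′j))
                        (two-terms≤sumFin (degL R) (x′≢x ∘ sym))
  in  ⊥-elim (<-irrefl refl (≤-trans 3≤links (≤-reflexive (≡ᵇ⇒≡ _ 2 two-links))))

1≤λK22R : (R : Rel a b) → 1 ≤ λK22R R
1≤λK22R R with isMatching R | isK12-centreR R
... | true  | _     = s≤s z≤n
... | false | true  = s≤s z≤n
... | false | false = s≤s z≤n

isSubK22⇒degL≤λK22R : (R : Rel a b) → T (isSubK22 R) → ∀ x → degL R x ≤ λK22R R
isSubK22⇒degL≤λK22R R h x with isMatching R in matching
... | true = isMatching⇒degL≤1 R (from T-≡ matching) x
... | false with isK12-centreR R in k12
...   | true  = isK12-centreR⇒degL≤1 R (from T-≡ k12) x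
...   | false = isSubK22⇒degL≤2 R h x

isMatching-flipR : (R : Rel a b) → isMatching (flipR R) ≡ isMatching R
isMatching-flipR R = ∧-comm (allB (λ j → degR R j ≤ᵇ 1)) (allB (λ i → degL R i ≤ᵇ 1))

isSubK22-flipR : (R : Rel a b) → isSubK22 (flipR R) ≡ isSubK22 R
isSubK22-flipR R = ∧-comm (count (λ j → 1 ≤ᵇ degR R j) ≤ᵇ 2) (count (λ i → 1 ≤ᵇ degL R i) ≤ᵇ 2)

flipD-involutive : (d : Maybe (Decomp a b)) → flipD (flipD d) ≡ d
flipD-involutive (just _) = refl
flipD-involutive nothing  = refl

λR-matching : (R : Rel a b) (d : Maybe (Decomp a b)) → isMatching R ≡ true → λR R d ≡ 1
λR-matching R d matching rewrite matching = refl

λR-subK22 : (R : Rel a b) (d : Maybe (Decomp a b)) →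
            isMatching R ≡ false → isSubK22 R ≡ true → λR R d ≡ λK22R R
λR-subK22 R d ¬matching subK22 with isMatching R in matching | isSubK22 R | d
λR-subK22 R d refl refl | false | true | just _  rewrite matching = refl
λR-subK22 R d refl refl | false | true | nothing rewrite matching = refl

λR-split : (R M′ M″ : Rel a b) → isMatching R ≡ false → isSubK22 R ≡ false →
           λR R (just (M′ , M″)) ≡ 1 + λK22R M″
λR-split R M′ M″ ¬matching ¬subK22 rewrite ¬matching | ¬subK22 = refl

matching-conclusions : (R : Rel a b) → T (isMatching R) → Conclusions R 1 1
matching-conclusions R matching =
  deg≤1 , ≤-trans (≤-reflexive (count-none no-heavy)) z≤n , λ { (s≤s ()) }
  where
  deg≤1 : ∀ x → degL R x ≤ 1
  deg≤1 = isMatching⇒degL≤1 R matching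
  no-heavy : ∀ x → ¬ T (2 ≤ᵇ degL R x)
  no-heavy x heavy = <-irrefl refl (≤-trans (≤ᵇ⇒≤ 2 _ heavy) (deg≤1 x))

subK22-conclusions : (R : Rel a b) → T (isSubK22 R) → ∀ lu → Conclusions R lu (λK22R R)
subK22-conclusions R subK22 lu =
  isSubK22⇒degL≤λK22R R subK22 ,
  ≤-trans (count-≤ᵇ-antitone (degL R) (s≤s z≤n)) non-isolated≤2 ,
  λ _ → ≤-trans (count-≤ᵇ-antitone (degL R) (⊓-glb (s≤s z≤n) (1≤λK22R R))) non-isolated≤2
  where
  non-isolated≤2 : count (λ x → 1 ≤ᵇ degL R x) ≤ 2
  non-isolated≤2 = ≤ᵇ⇒≤ _ 2 (proj₁ (to T-∧ subK22))

split-conclusions : (R M′ M″ : Rel a b) → T (isMatching M′) → T (isSubK22 M″) →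
                    (∀ x y → T (R x y) → T (M′ x y ∨ M″ x y)) →
                    ∀ lu → Conclusions R lu (1 + λK22R M″)
split-conclusions R M′ M″ matching subK22 R⊆M′∪M″ lu =
  (λ x → ≤-trans (deg≤1+deg″ x) (+-monoʳ-≤ 1 (isSubK22⇒degL≤λK22R M″ subK22 x))) ,
  heavy≤2 ,
  λ _ → subst (λ k → count (λ x → k ≤ᵇ degL R x) ≤ 2)
              (sym (m≤n⇒m⊓n≡m (s≤s (1≤λK22R M″)))) heavy≤2
  where
  deg≤1+deg″ : ∀ x → degL R x ≤ 1 + degL M″ x
  deg≤1+deg″ x = ≤-trans (≤-trans (count-mono (R⊆M′∪M″ x)) (count-∨ (M′ x) (M″ x)))
                         (+-monoˡ-≤ (degL M″ x) (isMatching⇒degL≤1 M′ matching x))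
  heavy≤2 : count (λ x → 2 ≤ᵇ degL R x) ≤ 2
  heavy≤2 = ≤-trans (count-mono (λ x heavy → ≤⇒≤ᵇ (s≤s⁻¹ (≤-trans (≤ᵇ⇒≤ 2 _ heavy) (deg≤1+deg″ x)))))
                    (≤ᵇ⇒≤ _ 2 (proj₁ (to T-∧ subK22)))

-- Admissible is condition (1) of a valid cover, minus the link-disjointness of M′ and M″,
-- which the degree bounds never use.
Split : Rel a b → Maybe (Decomp a b) → Set
Split R d = ∃₂ λ M′ M″ → d ≡ just (M′ , M″) × T (isMatching M′) × T (isSubK22 M″)
                        × (∀ x y → R x y ≡ (M′ x y ∨ M″ x y))

Admissible : Rel a b → Maybe (Decomp a b) → Set
Admissible R d = T (isMatching R) ⊎ T (isSubK22 R) ⊎ Split R d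

Admissible-flip : (R : Rel a b) (d : Maybe (Decomp a b)) → Admissible R d → Admissible (flipR R) (flipD d)
Admissible-flip R d (inj₁ matching) = inj₁ (subst T (sym (isMatching-flipR R)) matching)
Admissible-flip R d (inj₂ (inj₁ subK22)) = inj₂ (inj₁ (subst T (sym (isSubK22-flipR R)) subK22))
Admissible-flip R d (inj₂ (inj₂ (M′ , M″ , refl , matching , subK22 , R≡))) =
  inj₂ (inj₂ (flipR M′ , flipR M″ , refl ,
              subst T (sym (isMatching-flipR M′)) matching ,
              subst T (sym (isSubK22-flipR M″)) subK22 ,
              λ x y → R≡ y x))

admissible-conclusions : (R : Rel a b) (d : Maybe (Decomp a b)) → Admissible R d →
                         Conclusions R (λL R d) (λR R d)
admissible-conclusions R d adm with T? (isMatching R) | T? (isSubK22 R) | adm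
... | yes matching | _ | _
  rewrite λR-matching R d (to T-≡ matching)
        | λR-matching (flipR R) (flipD d) (trans (isMatching-flipR R) (to T-≡ matching)) =
  matching-conclusions R matching
... | no ¬matching | yes subK22 | _
  rewrite λR-subK22 R d (¬T⇒≡false ¬matching) (to T-≡ subK22) =
  subK22-conclusions R subK22 (λL R d)
... | no ¬matching | no ¬subK22 | inj₁ matching = contradiction matching ¬matching
... | no ¬matching | no ¬subK22 | inj₂ (inj₁ subK22) = contradiction subK22 ¬subK22
... | no ¬matching | no ¬subK22 | inj₂ (inj₂ (M′ , M″ , refl , matching′ , subK22″ , R≡))
  rewrite λR-split R M′ M″ (¬T⇒≡false ¬matching) (¬T⇒≡false ¬subK22) =
  split-conclusions R M′ M″ matching′ subK22″ (λ x y → subst T (R≡ x y)) (λL R (just (M′ , M″)))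

admissible-conclusions-both : (R : Rel a b) (d : Maybe (Decomp a b)) → Admissible R d →
                              Conclusions R (λL R d) (λR R d) × Conclusions (flipR R) (λR R d) (λL R d)
admissible-conclusions-both R d adm =
  admissible-conclusions R d adm ,
  subst (λ d′ → Conclusions (flipR R) (λR R d′) (λL R d)) (flipD-involutive d)
        (admissible-conclusions (flipR R) (flipD d) (Admissible-flip R d adm))

edge-admissible : ∀ {n} {G : BrokenOuterplanar n} {C : Cover n} → Valid G C →
                  ∀ {i j} → IsEdge G i j → Admissible (Cover.M C i j) (Cover.dec C i j)
edge-admissible {G = G} V {i} {j} e with T? (pathB G i j)
... | no  ¬path = inj₁ (Valid.v2 V i j e ¬path)
... | yes path  with Valid.v1 V i j e path
...   | inj₁ matching = inj₁ matching
...   | inj₂ (inj₁ subK22) = inj₂ (inj₁ subK22)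
...   | inj₂ (inj₂ ((M′ , M″) , d≡ , matching , subK22 , _ , R≡)) =
  inj₂ (inj₂ (M′ , M″ , d≡ , matching , subK22 , R≡))

lemma1 : ∀ {n} (G : BrokenOuterplanar n) (C : Cover n) → Valid G C →
         ∀ i j → IsEdge G i j →
           Conclusions (Cover.M C i j)
                       (λL (Cover.M C i j) (Cover.dec C i j))
                       (λR (Cover.M C i j) (Cover.dec C i j))
         × Conclusions (flipR (Cover.M C i j))
                       (λR (Cover.M C i j) (Cover.dec C i j))
                       (λL (Cover.M C i j) (Cover.dec C i j))
lemma1 G C V i j e =
  admissible-conclusions-both (Cover.M C i j) (Cover.dec C i j) (edge-admissible V e)
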